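{- For every tree $T\subseteq\mathbb{N}^{<\mathbb{N}}$, $[\mathcal{JT}(T)]=\{\mathcal{J}(Z):Z\in[T]\}$.
   Context: Finite strings are coded by natural numbers via a fixed computable coding where $\sigma\subset\tau$ implies $\sigma<\tau$. A tree is a subset of $\mathbb{N}^{<\mathbb{N}}$ closed under initial segments; $[T]$ is the set of infinite paths. $\{e\}^\sigma(n)\downarrow$ means the $e$-th oracle machine with oracle $\sigma$ halts on $n$ within $|\sigma|$ steps; $\{e\}^Z_t(n)\downarrow$ means it halts in fewer than $t$ steps. Jump operator on reals: for $Z\in\mathbb{N}^{\mathbb{N}}$, $t_{ -1}=1$, $t_n=\max\{t_{n-1}+1,\mu t(\{n\}^Z_t(n)\downarrow)\}$ (or $t_{n-1}+1$ if no such $t$), and $\mathcal{J}(Z)(n)=Z\restriction t_n$. Jump function on strings: for $\sigma\in\mathbb{N}^{<\mathbb{N}}$, $t_{ -1}=1$, $t_n=\max\{t_{n-1}+1,\mu t(\{n\}^{\sigma\restriction t}(n)\downarrow)\}$ (or $t_{n-1}+1$), and $J(\sigma)=\langle\sigma\restriction t_0,\dots,\sigma\restriction t_{k-1}\rangle$ with $k$ least such that $t_k>|\sigma|$. The Jump Tree of $T$ is $\mathcal{JT}(T)=\{J(\sigma):\sigma\in T\}$. -}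

module Defs where

open import Data.Nat using (ℕ; zero; suc; pred; _<_; _⊔_; _≡ᵇ_)
open import Data.Bool using (Bool; true; false; _∧_; _∨_)
open import Data.List using (List; []; _∷_; map; upTo; take; length)
open import Data.Maybe using (Maybe; just; nothing)
open import Data.Product using (Σ; _×_; _,_)
open import Data.Sum using (_⊎_)
open import Relation.Binary.PropositionalEquality using (_≡_)
open import Relation.Nullary using (¬_)

_↾_ : {A : Set} → (ℕ → A) → ℕ → List A
f ↾ t = map f (upTo t)

-- σ ↾ t for a finite string is  take t σ.

-- A concrete model of oracle machines: oracle Turing machines over the
-- alphabet ℕ, with a read-only oracle tape (head moves ≤ 1 cell per step)
-- and a two-way infinite work tape (blank = 0) holding the input in cell 0.

-- Cantor unpairing (bijection ℕ → ℕ × ℕ)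
unpair : ℕ → ℕ × ℕ
unpair zero = 0 , 0
unpair (suc n) with unpair n
... | zero , b = suc b , 0
... | suc a , b = a , suc b

-- decoding naturals as lists of naturals (first argument is fuel)
decodeList : ℕ → ℕ → List ℕ
decodeList zero    _       = []
decodeList (suc f) zero    = []
decodeList (suc f) (suc c) with unpair c
... | a , b = a ∷ decodeList f b

record Instr : Set where
  constructor instr
  field
    q a w q' w' dm om : ℕ
  -- in state q reading oracle symbol a and work symbol w:
  -- go to state q', write w', move work head by dm, oracle head by om
  -- (moves: 0 = left, 1 = stay, otherwise right)

decodeInstr : ℕ → Instr
decodeInstr c with unpair c
... | q , c1 with unpair c1
... | a , c2 with unpair c2
... | w , c3 with unpair c3
... | q' , c4 with unpair c4
... | w' , c5 with unpair c5
... | dm , om = instr q a w q' w' dm om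

prog : ℕ → List Instr
prog e = map decodeInstr (decodeList e e)

record Config : Set where
  constructor cfg
  field
    st  : ℕ
    oh  : ℕ        -- oracle head position
    lt  : List ℕ   -- work tape left of head (reversed)
    cur : ℕ
    rt  : List ℕ
open Config

initCfg : ℕ → Config
initCfg n = cfg 0 0 [] n []

moveW : ℕ → List ℕ → ℕ → List ℕ → (List ℕ × ℕ × List ℕ)
moveW zero [] c r = [] , 0 , c ∷ r
moveW zero (x ∷ l) c r = l , x , c ∷ r
moveW (suc zero) l c r = l , c , r
moveW (suc (suc _)) l c [] = c ∷ l , 0 , []
moveW (suc (suc _)) l c (x ∷ r) = c ∷ l , x , r

moveO : ℕ → ℕ → ℕ
moveO zero h = pred h
moveO (suc zero) h = h
moveO (suc (suc _)) h = suc h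

apply : Instr → Config → Config
apply i c with moveW (Instr.dm i) (lt c) (Instr.w' i) (rt c)
... | l , x , r = cfg (Instr.q' i) (moveO (Instr.om i) (oh c)) l x r

find : List Instr → ℕ → ℕ → ℕ → Maybe Instr
find [] q a w = nothing
find (i ∷ is) q a w with (Instr.q i ≡ᵇ q) ∧ (Instr.a i ≡ᵇ a) ∧ (Instr.w i ≡ᵇ w)
... | true  = just i
... | false = find is q a w

-- an oracle: partial access to a (finite or infinite) sequence
Oracle : Set
Oracle = ℕ → Maybe ℕ

realOracle : (ℕ → ℕ) → Oracle
realOracle Z i = just (Z i)

strOracle : List ℕ → Oracle
strOracle [] i = nothing
strOracle (x ∷ xs) zero = just x
strOracle (x ∷ xs) (suc i) = strOracle xs i

data Res : Set where
  halted stuck : Res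
  running : Config → Res

-- one step: read the oracle at the head (undefined read ⇒ stuck);
-- no applicable instruction ⇒ halted
step : List Instr → Oracle → Config → Res
step P O c with O (oh c)
... | nothing = stuck
... | just a with find P (st c) a (cur c)
...   | nothing = halted
...   | just i  = running (apply i c)

exec : List Instr → Oracle → ℕ → ℕ → Res
exec P O n zero = running (initCfg n)
exec P O n (suc s) with exec P O n s
... | running c = step P O c
... | r = r

isHalted : Res → Bool
isHalted halted = true
isHalted _ = false

haltsBelow : Oracle → ℕ → ℕ → ℕ → Bool
haltsBelow O e n zero = false
haltsBelow O e n (suc t) = isHalted (exec (prog e) O n t) ∨ haltsBelow O e n t

RHalts : (ℕ → ℕ) → ℕ → ℕ → ℕ → Set
RHalts Z e t n = haltsBelow (realOracle Z) e n t ≡ true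

-- {e}^σ(n)↓ : halts within |σ| steps (same step convention)
SHalts : List ℕ → ℕ → ℕ → Set
SHalts σ e n = haltsBelow (strOracle σ) e n (length σ) ≡ true

-- The jump sequences t_n, for a halting predicate H n t
-- ("{n}^{X↾t}(n)↓", resp. "{n}^Z_t(n)↓")

IsLeast : (ℕ → Set) → ℕ → Set
IsLeast P t = P t × (∀ t' → t' < t → ¬ P t')

JumpStep : (ℕ → ℕ → Set) → ℕ → ℕ → ℕ → Set
JumpStep H n p t =
  (Σ ℕ λ m → IsLeast (H n) m × t ≡ suc p ⊔ m)
  ⊎ ((∀ m → ¬ H n m) × t ≡ suc p)

-- t_{n-1}, with t_{-1} = 1
prevT : (ℕ → ℕ) → ℕ → ℕ
prevT ts zero = 1
prevT ts (suc n) = ts n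

IsTSeq : (ℕ → ℕ → Set) → (ℕ → ℕ) → Set
IsTSeq H ts = ∀ n → JumpStep H n (prevT ts n) (ts n)

IsRealJump : (ℕ → ℕ) → (ℕ → List ℕ) → Set
IsRealJump Z Y =
  Σ (ℕ → ℕ) λ ts → IsTSeq (λ n t → RHalts Z n t n) ts
    × (∀ n → Y n ≡ Z ↾ ts n)

IsStrJump : List ℕ → List (List ℕ) → Set
IsStrJump σ ys =
  Σ (ℕ → ℕ) λ ts → IsTSeq (λ n t → SHalts (take t σ) n n) ts
    × Σ ℕ λ k → IsLeast (λ k → length σ < ts k) k
    × ys ≡ map (λ i → take (ts i) σ) (upTo k)

IsTree : {A : Set} → (List A → Set) → Set
IsTree T = ∀ σ n → T σ → T (take n σ)

IsPath : {A : Set} → (List A → Set) → (ℕ → A) → Set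
IsPath T X = ∀ k → T (X ↾ k)

JT : (List ℕ → Set) → List (List ℕ) → Set
JT T ys = Σ (List ℕ) λ σ → T σ × IsStrJump σ ys

module Submission where

-- Everything rests on the use principle: a computation of fewer than t steps
-- reads the oracle only below t, so {e}^{Z↾t}(n)↓ iff {e}^Z_t(n)↓.  Hence, as
-- long as the halting times stay within a common initial segment of Z, the
-- string jump of that segment and the real jump of Z compute the same t_n.

open import Defs
open import Data.Bool using (Bool; true; false; _∨_)
open import Data.Bool.Properties using (∨-zeroʳ)
open import Data.List using (List; []; _∷_; upTo; take; length; applyUpTo)
open import Data.List.Properties
  using (length-map; length-upTo; length-take; map-upTo; take-take; ∷-injective)
open import Data.Maybe using (just; nothing)
open import Data.Nat
open import Data.Nat.Properties
open import Data.Product using (Σ; _×_; _,_; proj₁; proj₂)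
open import Data.Sum using (inj₁; inj₂)
open import Function using (_∘_; id)
open import Function.Bundles using (_⇔_; mk⇔)
open import Relation.Binary.Definitions using (tri<; tri≈; tri>)
open import Relation.Binary.PropositionalEquality
open import Relation.Nullary using (¬_; contradiction)

open Config

cast : {A B : Set} → A ≡ B → A → B
cast = subst id

module _ {A : Set} where

  -- Three facts about applyUpTo f t = ⟨f 0, …, f (t-1)⟩, the normal form of f ↾ t.
  applyUpTo-cong : (f g : ℕ → A) (t : ℕ) → (∀ i → i < t → f i ≡ g i) →
                   applyUpTo f t ≡ applyUpTo g t
  applyUpTo-cong f g zero    eq = refl
  applyUpTo-cong f g (suc t) eq =
    cong₂ _∷_ (eq 0 z<s) (applyUpTo-cong (f ∘ suc) (g ∘ suc) t (λ i i<t → eq (suc i) (s<s i<t)))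

  applyUpTo-injective : (f g : ℕ → A) (s t : ℕ) → applyUpTo f s ≡ applyUpTo g t →
                        s ≡ t × (∀ i → i < s → f i ≡ g i)
  applyUpTo-injective f g zero    zero    eq = refl , λ i ()
  applyUpTo-injective f g (suc s) (suc t) eq with ∷-injective eq
  ... | eq₀ , eq₊ with applyUpTo-injective (f ∘ suc) (g ∘ suc) s t eq₊
  ...   | refl , pointwise =
    refl , λ { zero _ → eq₀ ; (suc i) (s<s i<s) → pointwise i i<s }

  take-applyUpTo : (f : ℕ → A) (m t : ℕ) → take m (applyUpTo f t) ≡ applyUpTo f (m ⊓ t)
  take-applyUpTo f zero    t       = refl
  take-applyUpTo f (suc m) zero    = refl
  take-applyUpTo f (suc m) (suc t) = cong (f 0 ∷_) (take-applyUpTo (f ∘ suc) m t)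

  ↾-length : (f : ℕ → A) (t : ℕ) → length (f ↾ t) ≡ t
  ↾-length f t = trans (length-map f (upTo t)) (length-upTo t)

  ↾-cong : (f g : ℕ → A) (t : ℕ) → (∀ i → i < t → f i ≡ g i) → f ↾ t ≡ g ↾ t
  ↾-cong f g t eq rewrite map-upTo f t | map-upTo g t = applyUpTo-cong f g t eq

  ↾-injective : (f g : ℕ → A) {s t : ℕ} → f ↾ s ≡ g ↾ t →
                s ≡ t × (∀ i → i < s → f i ≡ g i)
  ↾-injective f g {s} {t} eq =
    applyUpTo-injective f g s t (trans (sym (map-upTo f s)) (trans eq (map-upTo g t)))

  take-↾ : (f : ℕ → A) (m t : ℕ) → take m (f ↾ t) ≡ f ↾ (m ⊓ t)
  take-↾ f m t rewrite map-upTo f t | map-upTo f (m ⊓ t) = take-applyUpTo f m t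

strOracle-↾ : (Z : ℕ → ℕ) {i t : ℕ} → i < t → strOracle (Z ↾ t) i ≡ just (Z i)
strOracle-↾ Z {i} {t} i<t rewrite map-upTo Z t = go Z i t i<t
  where
  go : (Z : ℕ → ℕ) (i t : ℕ) → i < t → strOracle (applyUpTo Z t) i ≡ just (Z i)
  go Z zero    (suc t) _           = refl
  go Z (suc i) (suc t) (s<s i<t) = go (Z ∘ suc) i t i<t

-- The i-th entry of a string (0 beyond its end).
entry : List ℕ → ℕ → ℕ
entry []      i       = 0
entry (x ∷ σ) zero    = x
entry (x ∷ σ) (suc i) = entry σ i

entry-take : (σ : List ℕ) {i a : ℕ} → i < a → entry (take a σ) i ≡ entry σ i
entry-take []      {i}     {suc a} _         = refl
entry-take (x ∷ σ) {zero}  {suc a} _         = refl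
entry-take (x ∷ σ) {suc i} {suc a} (s<s i<a) = entry-take σ i<a

entries-↾ : (σ : List ℕ) (Z : ℕ → ℕ) → (∀ i → i < length σ → entry σ i ≡ Z i) →
            σ ≡ Z ↾ length σ
entries-↾ σ Z eq rewrite map-upTo Z (length σ) = go σ Z eq
  where
  go : (σ : List ℕ) (Z : ℕ → ℕ) → (∀ i → i < length σ → entry σ i ≡ Z i) →
       σ ≡ applyUpTo Z (length σ)
  go []      Z eq = refl
  go (x ∷ σ) Z eq = cong₂ _∷_ (eq 0 z<s) (go σ (Z ∘ suc) (λ i i<σ → eq (suc i) (s<s i<σ)))

_≼_ : List ℕ → List ℕ → Set
ρ ≼ σ = ρ ≡ take (length ρ) σ

Compatible : List ℕ → List ℕ → Set
Compatible ρ τ = Σ (List ℕ) λ σ → ρ ≼ σ × τ ≼ σ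

compatible-entry : {ρ τ : List ℕ} → Compatible ρ τ → {i : ℕ} →
                   i < length ρ → i < length τ → entry ρ i ≡ entry τ i
compatible-entry {ρ} {τ} (σ , ρ≼σ , τ≼σ) {i} i<ρ i<τ = begin
  entry ρ i                        ≡⟨ cong (λ x → entry x i) ρ≼σ ⟩
  entry (take (length ρ) σ) i      ≡⟨ entry-take σ i<ρ ⟩
  entry σ i                        ≡⟨ sym (entry-take σ i<τ) ⟩
  entry (take (length τ) σ) i      ≡⟨ cong (λ x → entry x i) (sym τ≼σ) ⟩
  entry τ i                        ∎
  where open ≡-Reasoning

limit : (ℕ → List ℕ) → ℕ → ℕ
limit Y i = entry (Y i) i

limit-↾ : (Y : ℕ → List ℕ) → (∀ i → i < length (Y i)) →
          (∀ i j → Compatible (Y i) (Y j)) → ∀ i → Y i ≡ limit Y ↾ length (Y i)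
limit-↾ Y long compatible i =
  entries-↾ (Y i) (limit Y) λ m m<Yi → compatible-entry (compatible i m) m<Yi (long m)

-- The machine model: the use principle and monotonicity of halting

moveO-≤ : ∀ o h → moveO o h ≤ suc h
moveO-≤ zero          h = ≤-trans pred[n]≤n (n≤1+n h)
moveO-≤ (suc zero)    h = n≤1+n h
moveO-≤ (suc (suc o)) h = ≤-refl

apply-head : ∀ i c → oh (apply i c) ≤ suc (oh c)
apply-head i c with moveW (Instr.dm i) (lt c) (Instr.w' i) (rt c)
... | _ = moveO-≤ (Instr.om i) (oh c)

step-head : ∀ P O c {c'} → step P O c ≡ running c' → oh c' ≤ suc (oh c)
step-head P O c e with O (oh c)
... | just a with find P (st c) a (cur c)
step-head P O c refl | just a | just i = apply-head i c
step-head P O c ()   | just a | nothing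
step-head P O c ()   | nothing

exec-head : ∀ P O n s {c} → exec P O n s ≡ running c → oh c ≤ s
exec-head P O n zero refl = z≤n
exec-head P O n (suc s) e with exec P O n s | exec-head P O n s
... | running c₀ | head = ≤-trans (step-head P O c₀ e) (s≤s (head refl))
exec-head P O n (suc s) () | halted | _
exec-head P O n (suc s) () | stuck  | _

step-oracle : ∀ P {O O'} c → O (oh c) ≡ O' (oh c) → step P O c ≡ step P O' c
step-oracle P {O} {O'} c eq with O (oh c) | O' (oh c) | eq
... | _ | _ | refl = refl

exec-use : ∀ P {O O'} n {t} → (∀ i → i < t → O i ≡ O' i) →
           ∀ s → s ≤ t → exec P O n s ≡ exec P O' n s
exec-use P n agree zero _ = refl
exec-use P {O} {O'} n agree (suc s) s<t
  with exec P O n s | exec P O' n s | exec-use P n agree s (<⇒≤ s<t) | exec-head P O n s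
... | running c | _ | refl | head =
  step-oracle P {O} {O'} c (agree (oh c) (≤-<-trans (head refl) s<t))
... | halted    | _ | refl | _    = refl
... | stuck     | _ | refl | _    = refl

haltsBelow-use : ∀ {O O'} e n t → (∀ i → i < t → O i ≡ O' i) →
                 haltsBelow O e n t ≡ haltsBelow O' e n t
haltsBelow-use e n zero    agree = refl
haltsBelow-use e n (suc t) agree =
  cong₂ _∨_ (cong isHalted (exec-use (prog e) n agree t (n≤1+n t)))
            (haltsBelow-use e n t λ i i<t → agree i (m<n⇒m<1+n i<t))

SHalts-↾ : ∀ Z m e n → SHalts (Z ↾ m) e n ≡ RHalts Z e m n
SHalts-↾ Z m e n = cong (_≡ true) (begin
  haltsBelow (strOracle (Z ↾ m)) e n (length (Z ↾ m))
    ≡⟨ cong (haltsBelow _ e n) (↾-length Z m) ⟩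
  haltsBelow (strOracle (Z ↾ m)) e n m
    ≡⟨ haltsBelow-use e n m (λ i → strOracle-↾ Z) ⟩
  haltsBelow (realOracle Z) e n m
    ∎)
  where open ≡-Reasoning

haltsBelow-mono : ∀ O e n {t t'} → t ≤ t' →
                  haltsBelow O e n t ≡ true → haltsBelow O e n t' ≡ true
haltsBelow-mono O e n t≤t' = go (≤⇒≤′ t≤t')
  where
  go : ∀ {t t'} → t ≤′ t' → haltsBelow O e n t ≡ true → haltsBelow O e n t' ≡ true
  go ≤′-refl        h = h
  go (≤′-step t≤t') h rewrite go t≤t' h = ∨-zeroʳ _

RealHalt : (ℕ → ℕ) → ℕ → ℕ → Set
RealHalt Z n t = RHalts Z n t n

StrHalt : List ℕ → ℕ → ℕ → Set
StrHalt σ n t = SHalts (take t σ) n n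

module _ {H : ℕ → ℕ → Set} where

  jumpStep-above : ∀ {n p t} → JumpStep H n p t → p < t
  jumpStep-above {p = p} (inj₁ (m , _ , refl)) = m≤m⊔n (suc p) m
  jumpStep-above         (inj₂ (_ , refl))     = ≤-refl

  jumpStep-haltsBy : ∀ {n p t} → JumpStep H n p t →
                     Σ ℕ (H n) → Σ ℕ λ m' → m' ≤ t × H n m'
  jumpStep-haltsBy {p = p} (inj₁ (m' , (h , _) , refl)) _       = m' , m≤n⊔m (suc p) m' , h
  jumpStep-haltsBy         (inj₂ (never , _))           (m , h) = contradiction h (never m)

  least-unique : ∀ {n m m'} → IsLeast (H n) m → IsLeast (H n) m' → m ≡ m'
  least-unique {m = m} {m'} (h , least) (h' , least') with <-cmp m m'
  ... | tri< m<m' _ _ = contradiction h (least' m m<m')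
  ... | tri≈ _ m≡m' _ = m≡m'
  ... | tri> _ _ m'<m = contradiction h' (least m' m'<m)

  jumpStep-unique : ∀ {n p t t'} → JumpStep H n p t → JumpStep H n p t' → t ≡ t'
  jumpStep-unique (inj₁ (_ , l , refl)) (inj₁ (_ , l' , refl)) = cong (_ ⊔_) (least-unique l l')
  jumpStep-unique (inj₁ (_ , l , _))    (inj₂ (never , _))     = contradiction (proj₁ l) (never _)
  jumpStep-unique (inj₂ (never , _))    (inj₁ (_ , l' , _))    = contradiction (proj₁ l') (never _)
  jumpStep-unique (inj₂ (_ , refl))     (inj₂ (_ , refl))      = refl

  module _ {ts : ℕ → ℕ} (seq : IsTSeq H ts) where

    prevT-above : ∀ n → n < prevT ts n
    prevT-above zero    = z<s
    prevT-above (suc n) = ≤-<-trans (prevT-above n) (jumpStep-above (seq n))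

    ts-above : ∀ n → n < ts n
    ts-above n = <-trans (prevT-above n) (jumpStep-above (seq n))

    ts-below-prevT : ∀ {n K} → n < K → ts n ≤ prevT ts K
    ts-below-prevT {n} {suc K} n<1+K with m<1+n⇒m<n∨m≡n n<1+K
    ... | inj₂ refl = ≤-refl
    ... | inj₁ n<K  = ≤-trans (ts-below-prevT n<K) (<⇒≤ (jumpStep-above (seq K)))

jumpStep-transfer : ∀ {H H' : ℕ → ℕ → Set} {n p t} →
  (∀ m → m ≤ t → H n m ≡ H' n m) → (Σ ℕ (H' n) → Σ ℕ (H n)) →
  JumpStep H n p t → JumpStep H' n p t
jumpStep-transfer {p = p} {t} agree reflect (inj₁ (m , (h , least) , refl)) =
  inj₁ (m , (cast (agree m m≤t) h ,
             λ m' m'<m → least m' m'<m ∘ cast (sym (agree m' (m'≤t m'<m)))) , refl)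
  where
  m≤t = m≤n⊔m (suc p) m
  m'≤t : ∀ {m'} → m' < m → m' ≤ t
  m'≤t m'<m = ≤-trans (<⇒≤ m'<m) m≤t
jumpStep-transfer agree reflect (inj₂ (never , refl)) =
  inj₂ ((λ m h' → let (m' , h) = reflect (m , h') in never m' h) , refl)

least-witness : (b : ℕ → Bool) {L : ℕ} → b L ≡ true → Σ ℕ (IsLeast (λ m → b m ≡ true))
least-witness b {zero} hL = 0 , hL , λ _ ()
least-witness b {suc L} hL with b 0 in h₀
... | true  = 0 , h₀ , λ _ ()
... | false with least-witness (b ∘ suc) hL
...   | m , h , least = suc m , h , λ { zero _ h₀' → contradiction (trans (sym h₀) h₀') λ () ;
                                       (suc m') (s<s m'<m) → least m' m'<m }

jumpSeq-exists : (b : ℕ → ℕ → Bool) (B : ℕ) → (∀ n m → b n m ≡ true → b n B ≡ true) →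
                 Σ (ℕ → ℕ) (IsTSeq (λ n m → b n m ≡ true))
jumpSeq-exists b B settled = seq , isSeq
  where
  jumpStep : ∀ n p → Σ ℕ (JumpStep (λ n m → b n m ≡ true) n p)
  jumpStep n p with b n B in hB
  ... | true  = let (m , least) = least-witness (b n) hB in suc p ⊔ m , inj₁ (m , least , refl)
  ... | false =
    suc p , inj₂ ((λ m h → contradiction (trans (sym hB) (settled n m h)) λ ()) , refl)

  seq : ℕ → ℕ
  seq zero    = proj₁ (jumpStep 0 1)
  seq (suc n) = proj₁ (jumpStep (suc n) (seq n))

  isSeq : IsTSeq (λ n m → b n m ≡ true) seq
  isSeq zero    = proj₂ (jumpStep 0 1)
  isSeq (suc n) = proj₂ (jumpStep (suc n) (seq n))

-- (⇐)  J(Z ↾ t_{K-1}) = 𝒥(Z) ↾ K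

module RestrictedJump (Z : ℕ → ℕ) {ts : ℕ → ℕ} (seq : IsTSeq (RealHalt Z) ts) (K : ℕ)
  where

  L : ℕ
  L = prevT ts K

  σ : List ℕ
  σ = Z ↾ L

  strHalt-σ : ∀ n m → StrHalt σ n m ≡ RealHalt Z n (m ⊓ L)
  strHalt-σ n m = trans (cong (λ ρ → SHalts ρ n n) (take-↾ Z m L)) (SHalts-↾ Z (m ⊓ L) n n)

  strHalt-agree : ∀ n {m} → m ≤ L → RealHalt Z n m ≡ StrHalt σ n m
  strHalt-agree n {m} m≤L =
    sym (trans (strHalt-σ n m) (cong (RealHalt Z n) (m≤n⇒m⊓n≡m m≤L)))

  strHalt-settled : ∀ n m → StrHalt σ n m → StrHalt σ n L
  strHalt-settled n m h = cast (sym (trans (strHalt-σ n L) (cong (RealHalt Z n) (⊓-idem L))))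
    (haltsBelow-mono (realOracle Z) n n (m⊓n≤n m L) (cast (strHalt-σ n m) h))

  strSeq : Σ (ℕ → ℕ) (IsTSeq (StrHalt σ))
  strSeq = jumpSeq-exists (λ n m → haltsBelow (strOracle (take m σ)) n n (length (take m σ)))
                          L strHalt-settled

  ts' : ℕ → ℕ
  ts' = proj₁ strSeq

  ts'≡ts : ∀ n → n < K → ts' n ≡ ts n
  prevT'≡prevT : ∀ n → n ≤ K → prevT ts' n ≡ prevT ts n

  ts'≡ts n n<K = jumpStep-unique {StrHalt σ} (proj₂ strSeq n)
    (jumpStep-transfer {RealHalt Z} {StrHalt σ}
      (λ m m≤tn → strHalt-agree n (≤-trans m≤tn (ts-below-prevT seq n<K)))
      (λ (m , h) → m ⊓ L , cast (strHalt-σ n m) h)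
      (subst (λ p → JumpStep (RealHalt Z) n p (ts n)) (sym (prevT'≡prevT n (<⇒≤ n<K))) (seq n)))

  prevT'≡prevT zero    _   = refl
  prevT'≡prevT (suc n) n<K = ts'≡ts n n<K

  -- J(σ) = 𝒥(Z) ↾ K: the string jump stops exactly at K, where t_K exceeds |σ|.
  restrictedJump : IsStrJump σ ((λ n → Z ↾ ts n) ↾ K)
  restrictedJump = ts' , proj₂ strSeq , K , (length-σ<ts'K , ts'≤length-σ) ,
                   ↾-cong _ _ K λ i i<K →
                     sym (trans (take-↾ Z (ts' i) L) (cong (Z ↾_) (⊓L≡ i i<K)))
    where
    length-σ<ts'K : length σ < ts' K
    length-σ<ts'K = subst (_< ts' K) (trans (prevT'≡prevT K ≤-refl) (sym (↾-length Z L)))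
                          (jumpStep-above {StrHalt σ} (proj₂ strSeq K))

    ts'≤length-σ : ∀ k → k < K → ¬ length σ < ts' k
    ts'≤length-σ k k<K =
      ≤⇒≯ (subst₂ _≤_ (sym (ts'≡ts k k<K)) (sym (↾-length Z L)) (ts-below-prevT seq k<K))

    ⊓L≡ : ∀ i → i < K → ts' i ⊓ L ≡ ts i
    ⊓L≡ i i<K rewrite ts'≡ts i i<K = m≤n⇒m⊓n≡m (ts-below-prevT seq i<K)

-- (⇒)  a path through 𝒥𝒯(T) is the jump of a path through T

module JumpTreePath (T : List ℕ → Set) (tree : IsTree T) (Y : ℕ → List ℕ)
                    (path : IsPath (JT T) Y) where

  record Approximation (K : ℕ) : Set where
    field
      σ      : List ℕ
      σ∈T    : T σ
      ws     : ℕ → ℕ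
      wsSeq  : IsTSeq (StrHalt σ) ws
      Y≡take : ∀ i → i < K → Y i ≡ take (ws i) σ
      ws≤σ   : ∀ i → i < K → ws i ≤ length σ

  approximation : ∀ K → Approximation K
  approximation K with path K
  ... | σ , σ∈T , ws , wsSeq , k , (_ , k-least) , Y↾K≡ with ↾-injective Y _ Y↾K≡
  ...   | refl , Y≡take = record
    { σ = σ ; σ∈T = σ∈T ; ws = ws ; wsSeq = wsSeq ; Y≡take = Y≡take
    ; ws≤σ = λ i i<K → ≮⇒≥ (k-least i i<K) }

  -- The candidate jump sequence: t_n = |Y n|.
  ts : ℕ → ℕ
  ts n = length (Y n)

  module _ {K : ℕ} (a : Approximation K) where
    open Approximation a

    ws≡ts : ∀ i → i < K → ws i ≡ ts i
    ws≡ts i i<K = sym (begin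
      length (Y i)              ≡⟨ cong length (Y≡take i i<K) ⟩
      length (take (ws i) σ)    ≡⟨ length-take (ws i) σ ⟩
      ws i ⊓ length σ           ≡⟨ m≤n⇒m⊓n≡m (ws≤σ i i<K) ⟩
      ws i                      ∎)
      where open ≡-Reasoning

    Y≼σ : ∀ i → i < K → Y i ≼ σ
    Y≼σ i i<K = trans (Y≡take i i<K) (cong (λ t → take t σ) (ws≡ts i i<K))

  Y-long : ∀ n → n < ts n
  Y-long n = subst (n <_) (ws≡ts a n ≤-refl) (ts-above (Approximation.wsSeq a) n)
    where a = approximation (suc n)

  -- The real Z, and Y n = Z ↾ t_n since all Y i are compatible.
  Z : ℕ → ℕ
  Z = limit Y

  Y≡Z↾ : ∀ n → Y n ≡ Z ↾ ts n
  Y≡Z↾ = limit-↾ Y Y-long λ i j → let a = approximation (suc (i ⊔ j)) in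
    Approximation.σ a , Y≼σ a i (s≤s (m≤m⊔n i j)) , Y≼σ a j (s≤s (m≤n⊔m i j))

  module _ {K : ℕ} (a : Approximation K) where
    open Approximation a

    σ-follows-Z : ∀ {j m} → j < K → m ≤ ts j → take m σ ≡ Z ↾ m
    σ-follows-Z {j} {m} j<K m≤tj = begin
      take m σ               ≡⟨ cong (λ x → take x σ) (sym m⊓tj≡m) ⟩
      take (m ⊓ ts j) σ      ≡⟨ sym (take-take m (ts j) σ) ⟩
      take m (take (ts j) σ) ≡⟨ cong (take m) (sym (Y≼σ a j j<K)) ⟩
      take m (Y j)           ≡⟨ cong (take m) (Y≡Z↾ j) ⟩
      take m (Z ↾ ts j)      ≡⟨ take-↾ Z m (ts j) ⟩
      Z ↾ (m ⊓ ts j)         ≡⟨ cong (Z ↾_) m⊓tj≡m ⟩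
      Z ↾ m                  ∎
      where
      open ≡-Reasoning
      m⊓tj≡m = m≤n⇒m⊓n≡m m≤tj

    strHalt-agree : ∀ {j} n m → j < K → m ≤ ts j → StrHalt σ n m ≡ RealHalt Z n m
    strHalt-agree n m j<K m≤tj =
      trans (cong (λ ρ → SHalts ρ n n) (σ-follows-Z j<K m≤tj)) (SHalts-↾ Z m n n)

    jumpStep-at : ∀ n → n < K → JumpStep (StrHalt σ) n (prevT ts n) (ts n)
    jumpStep-at n n<K =
      subst₂ (JumpStep (StrHalt σ) n) (prevT-agree n n<K) (ws≡ts a n n<K) (wsSeq n)
      where
      prevT-agree : ∀ n → n < K → prevT ws n ≡ prevT ts n
      prevT-agree zero    _   = refl
      prevT-agree (suc n) n<K = ws≡ts a n (<-trans (n<1+n n) n<K)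

  -- If {n}^Z(n) halts at time m, the approximation for K₂ > n, m sees this,
  -- hence sees a halting time m' ≤ t_n; within t_n every approximation with
  -- K > n agrees with Z, so it sees m' too.
  halts-seen : ∀ {K} (a : Approximation K) n → n < K →
               Σ ℕ (RealHalt Z n) → Σ ℕ (StrHalt (Approximation.σ a) n)
  halts-seen a n n<K (m , h) =
    transport (jumpStep-haltsBy {StrHalt (Approximation.σ a₂)} (jumpStep-at a₂ n n<K₂) (m , h₂))
    where
    a₂  = approximation (suc (n ⊔ m))
    n<K₂ = s≤s (m≤m⊔n n m)
    h₂ : StrHalt (Approximation.σ a₂) n m
    h₂ = cast (sym (strHalt-agree a₂ n m (s≤s (m≤n⊔m n m)) (<⇒≤ (Y-long m)))) h

    transport : (Σ ℕ λ m' → m' ≤ ts n × StrHalt (Approximation.σ a₂) n m') →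
                Σ ℕ (StrHalt (Approximation.σ a) n)
    transport (m' , m'≤tn , h') =
      m' , cast (trans (strHalt-agree a₂ n m' n<K₂ m'≤tn) (sym (strHalt-agree a n m' n<K m'≤tn)))
                h'

  jumpSeq : IsTSeq (RealHalt Z) ts
  jumpSeq n = jumpStep-transfer {StrHalt (Approximation.σ a)} {RealHalt Z}
                (λ m m≤tn → strHalt-agree a n m (n<1+n n) m≤tn)
                (halts-seen a n (n<1+n n))
                (jumpStep-at a n (n<1+n n))
    where a = approximation (suc n)

  Z∈[T] : IsPath T Z
  Z∈[T] k = subst T (σ-follows-Z a (n<1+n k) (<⇒≤ (Y-long k))) (tree σ k σ∈T)
    where
    a = approximation (suc k)
    open Approximation a

  jumpOfPath : Σ (ℕ → ℕ) λ Z → IsPath T Z × IsRealJump Z Y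
  jumpOfPath = Z , Z∈[T] , ts , jumpSeq , Y≡Z↾

lemma4p9 : (T : List ℕ → Set) → IsTree T →
    (Y : ℕ → List ℕ) →
    IsPath (JT T) Y ⇔ (Σ (ℕ → ℕ) λ Z → IsPath T Z × IsRealJump Z Y)
lemma4p9 T tree Y = mk⇔ (JumpTreePath.jumpOfPath T tree Y) pathOfJump
  where
  pathOfJump : (Σ (ℕ → ℕ) λ Z → IsPath T Z × IsRealJump Z Y) → IsPath (JT T) Y
  pathOfJump (Z , Z∈[T] , ts , seq , Y≡) K =
    σ , Z∈[T] L , subst (IsStrJump σ) (↾-cong _ Y K λ i _ → sym (Y≡ i)) restrictedJump
    where open RestrictedJump Z seq K
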